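{- Let $\lambda_0, \lambda_1, \lambda_2, \mu_1, \mu_2 \in \mathbb{Z}$ be such that $\lambda_1 = 0$ implies $\mu_1 = 0$, and $\lambda_2 = 0$ implies $\mu_2 = 0$. Let $p \leq q$ be primes greater than $|\lambda_1|$ and $|\lambda_2|$. Then there exist maps $\alpha, \beta : \mathbb{Z}_p \oplus \mathbb{Z}_q \to \mathbb{Z}_p \oplus \mathbb{Z}_q$ such that the function \[f(x,y) = \lambda_0 \alpha(x)\beta(y) + \lambda_1\alpha(x) + \mu_1 x + \lambda_2\beta(y) + \mu_2 y\] takes at most $O(q)$ values as $x,y$ range over $\mathbb{Z}_p \oplus \mathbb{Z}_q$, where the implied constant depends only on $\lambda_0,\lambda_1,\lambda_2,\mu_1,\mu_2$ and not on $p,q$.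
   Context: $\mathbb{Z}_p \oplus \mathbb{Z}_q$ is regarded as a ring with coordinatewise operations; integers act on it via the natural maps $\mathbb{Z} \to \mathbb{Z}_p$, $\mathbb{Z}\to\mathbb{Z}_q$. -}

module Defs where

open import Data.Nat using (ℕ; zero; suc)
open import Data.Integer using (ℤ; +_; _+_; _*_; _%ℕ_)
open import Data.Fin using (Fin; toℕ)
open import Data.Product using (_×_; _,_; proj₁; proj₂)

ZZ : ℕ → ℕ → Set
ZZ p q = Fin p × Fin q

-- The natural map ℤ → Z_n, returning the canonical residue in {0,…,n-1}
-- (n = 0 never occurs for primes; the zero clause only makes the function total).
red : ℕ → ℤ → ℕ
red zero    z = 0
red (suc n) z = z %ℕ suc n

lift : {n : ℕ} → Fin n → ℤ
lift i = + toℕ i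

expr : (l0 l1 l2 m1 m2 : ℤ) → (a b x y : ℤ) → ℤ
expr l0 l1 l2 m1 m2 a b x y = l0 * a * b + l1 * a + m1 * x + l2 * b + m2 * y

-- Since ℤ → Z_n is a ring homomorphism, reducing the integer expression on lifts
-- computes exactly the ring operation in Z_p ⊕ Z_q.
fval : (p q : ℕ) (l0 l1 l2 m1 m2 : ℤ) (α β : ZZ p q → ZZ p q) → ZZ p q → ZZ p q → ℕ × ℕ
fval p q l0 l1 l2 m1 m2 α β x y =
  ( red p (expr l0 l1 l2 m1 m2 (lift (proj₁ (α x))) (lift (proj₁ (β y))) (lift (proj₁ x)) (lift (proj₁ y)))
  , red q (expr l0 l1 l2 m1 m2 (lift (proj₂ (α x))) (lift (proj₂ (β y))) (lift (proj₂ x)) (lift (proj₂ y))) )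

-- Let c₁ solve l₁c ≡ m₁ (mod p) and c₂ solve l₂c ≡ m₂ (mod q); such solutions exist because p and q
-- are primes exceeding |l₁| and |l₂| (for l = 0 the hypothesis m = 0 makes c = 0 a solution). Put
-- α(x) = (c₁(x₂ − x₁), 0) and β(y) = (0, c₂(y₁ − y₂)). The product α(x)β(y) vanishes, and in both
-- coordinates f(x, y) reduces to the residue of the single integer s = m₁x₂ + m₂y₁. Since x₂ < q and
-- y₁ < p ≤ q, |s| ≤ (|m₁| + |m₂|)q, so f takes at most (2(|m₁| + |m₂|) + 1)q values.
module Submission where

open import Defs
open import Data.Nat using (ℕ; _≤_; _<_; _*_)
open import Data.Nat.Primality using (Prime)
open import Data.Integer using (ℤ; ∣_∣; 0ℤ)
open import Data.Product using (Σ; _×_)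
open import Data.List using (List; length)
open import Data.List.Membership.Propositional using (_∈_)
open import Relation.Binary.PropositionalEquality using (_≡_)

import Data.Nat as ℕ
import Data.Nat.Properties as ℕP
open import Data.Nat.Coprimality using (coprime-Bézout; prime⇒coprime)
open import Data.Nat.Divisibility as ℕ∣ using ()
open import Data.Nat.GCD using (module Bézout)
open import Data.Nat.Primality using (prime⇒nonZero)
import Data.Integer as ℤ
open import Data.Integer
  using (+_; +[1+_]; -[1+_]; _+_; _-_; -_; _⊖_; 1ℤ; _%ℕ_; _/ℕ_)
  renaming (_*_ to _·_)
import Data.Integer.Properties as ℤP
open import Data.Integer.DivMod using (a≡a%ℕn+[a/ℕn]*n; n%ℕd<d)
open import Data.Integer.Divisibility.Signed
  using (_∣_; divides; ∣⇒∣ᵤ; ∣-refl; ∣n⇒∣m*n; ∣m⇒∣m*n; ∣m∣n⇒∣m+n; ∣m+n∣n⇒∣m)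
open import Data.Integer.Tactic.RingSolver using (solve-∀)
open import Data.Fin using (Fin; fromℕ<)
open import Data.Fin.Properties using (toℕ-fromℕ<; toℕ<n)
open import Data.List using (map; applyUpTo)
open import Data.List.Properties using (length-map; length-applyUpTo)
open import Data.List.Membership.Propositional.Properties using (∈-map⁺; ∈-applyUpTo⁺)
open import Data.Product using (_,_; proj₁; proj₂; ∃-syntax)
open import Relation.Binary.PropositionalEquality
  using (refl; sym; trans; cong; cong₂; subst; module ≡-Reasoning)
open import Relation.Nullary using (contradiction)

n∣d<n⇒d≡0 : ∀ {n d} → n ℕ∣.∣ d → d < n → d ≡ 0
n∣d<n⇒d≡0 {d = ℕ.zero}  _   _   = refl
n∣d<n⇒d≡0 {d = ℕ.suc _} n∣d d<n = contradiction n∣d (ℕ∣.>⇒∤ d<n)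

residue-unique : ∀ {n r s} → r < n → s < n → + n ∣ + r - + s → r ≡ s
residue-unique {n} {r} {s} r<n s<n n∣r-s =
  ℤP.+-injective (ℤP.i-j≡0⇒i≡j (+ r) (+ s) (ℤP.∣i∣≡0⇒i≡0 ∣r-s∣≡0))
  where
  ∣r-s∣<n : ∣ + r - + s ∣ < n
  ∣r-s∣<n = subst (_< n) (cong ∣_∣ (sym (ℤP.m-n≡m⊖n r s)))
                  (ℕP.≤-<-trans (ℤP.∣m⊝n∣≤m⊔n r s) (ℕP.⊔-lub r<n s<n))
  ∣r-s∣≡0 : ∣ + r - + s ∣ ≡ 0
  ∣r-s∣≡0 = n∣d<n⇒d≡0 (∣⇒∣ᵤ n∣r-s) ∣r-s∣<n

%ℕ-cong : ∀ {z w} n .{{_ : ℕ.NonZero n}} → + n ∣ z - w → z %ℕ n ≡ w %ℕ n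
%ℕ-cong {z} {w} n n∣z-w = residue-unique (n%ℕd<d z n) (n%ℕd<d w n) n∣r-r'
  where
  open ≡-Reasoning
  r = + (z %ℕ n) ; r' = + (w %ℕ n) ; t = z /ℕ n ; t' = w /ℕ n
  regroup : ∀ r r' t t' N → (r + t · N) - (r' + t' · N) ≡ (r - r') + (t - t') · N
  regroup = solve-∀
  z-w≡ : z - w ≡ (r - r') + (t - t') · + n
  z-w≡ = begin
    z - w                             ≡⟨ cong₂ _-_ (a≡a%ℕn+[a/ℕn]*n z n) (a≡a%ℕn+[a/ℕn]*n w n) ⟩
    (r + t · + n) - (r' + t' · + n)   ≡⟨ regroup r r' t t' (+ n) ⟩
    (r - r') + (t - t') · + n         ∎
  n∣r-r' : + n ∣ r - r'
  n∣r-r' = ∣m+n∣n⇒∣m (subst (+ n ∣_) z-w≡ n∣z-w) (∣n⇒∣m*n (t - t') ∣-refl)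

red-cong : ∀ n {z w} → + n ∣ z - w → red n z ≡ red n w
red-cong ℕ.zero    _     = refl
red-cong (ℕ.suc n) {z} {w} n∣z-w = %ℕ-cong {z} {w} (ℕ.suc n) n∣z-w

red<n : ∀ n .{{_ : ℕ.NonZero n}} z → red n z < n
red<n (ℕ.suc n) z = n%ℕd<d z (ℕ.suc n)

red-≡-mod : ∀ n .{{_ : ℕ.NonZero n}} z → + n ∣ + red n z - z
red-≡-mod n@(ℕ.suc _) z = divides (- (z /ℕ n)) (begin
  + red n z - z                          ≡⟨ cong (λ w → + red n z - w) (a≡a%ℕn+[a/ℕn]*n z n) ⟩
  + red n z - (+ red n z + z /ℕ n · + n) ≡⟨ cancel (+ red n z) (z /ℕ n) (+ n) ⟩
  - (z /ℕ n) · + n                       ∎)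
  where
  open ≡-Reasoning
  cancel : ∀ r t N → r - (r + t · N) ≡ (- t) · N
  cancel = solve-∀

reduce : ∀ n .{{_ : ℕ.NonZero n}} → ℤ → Fin n
reduce n z = fromℕ< (red<n n z)

lift∘reduce-≡-mod : ∀ n .{{_ : ℕ.NonZero n}} z → + n ∣ lift (reduce n z) - z
lift∘reduce-≡-mod n z = subst (λ a → + n ∣ a - z) (cong +_ (sym (toℕ-fromℕ< (red<n n z)))) (red-≡-mod n z)

1+ab≡cd⇒ℤ : ∀ {a b c d} → 1 ℕ.+ a ℕ.* b ≡ c ℕ.* d → 1ℤ + + a · + b ≡ + c · + d
1+ab≡cd⇒ℤ {a} {b} {c} {d} eq = begin
  1ℤ + + a · + b      ≡⟨ cong (λ w → 1ℤ + w) (ℤP.pos-* a b) ⟨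
  + (1 ℕ.+ a ℕ.* b)   ≡⟨ cong +_ eq ⟩
  + (c ℕ.* d)         ≡⟨ ℤP.pos-* c d ⟩
  + c · + d           ∎
  where open ≡-Reasoning

bézout⇒invertible : ∀ {p n} → Bézout.Identity 1 p n → ∃[ u ] + p ∣ + n · u - 1ℤ
bézout⇒invertible {p} {n} (Bézout.+- x y 1+yn≡xp) = - + y , divides (- + x) (begin
  + n · - + y - 1ℤ      ≡⟨ negate (+ n) (+ y) ⟩
  - (1ℤ + + y · + n)    ≡⟨ cong -_ (1+ab≡cd⇒ℤ {y} {n} {x} {p} 1+yn≡xp) ⟩
  - (+ x · + p)         ≡⟨ ℤP.neg-distribˡ-* (+ x) (+ p) ⟩
  - + x · + p           ∎)
  where
  open ≡-Reasoning
  negate : ∀ n y → n · - y - 1ℤ ≡ - (1ℤ + y · n)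
  negate = solve-∀
bézout⇒invertible {p} {n} (Bézout.-+ x y 1+xp≡yn) = + y , divides (+ x) (begin
  + n · + y - 1ℤ          ≡⟨ cong (_- 1ℤ) (ℤP.*-comm (+ n) (+ y)) ⟩
  + y · + n - 1ℤ          ≡⟨ cong (_- 1ℤ) (1+ab≡cd⇒ℤ {x} {p} {y} {n} 1+xp≡yn) ⟨
  1ℤ + + x · + p - 1ℤ     ≡⟨ cancel (+ x · + p) ⟩
  + x · + p               ∎)
  where
  open ≡-Reasoning
  cancel : ∀ a → 1ℤ + a - 1ℤ ≡ a
  cancel = solve-∀

inverse⇒solution : ∀ {p} l m → ∃[ u ] + p ∣ l · u - 1ℤ → ∃[ c ] + p ∣ l · c - m
inverse⇒solution {p} l m (u , p∣lu-1) =
  u · m , subst (+ p ∣_) (factor l u m) (∣m⇒∣m*n m p∣lu-1)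
  where
  factor : ∀ l u m → (l · u - 1ℤ) · m ≡ l · (u · m) - m
  factor = solve-∀

prime⇒invertible : ∀ {p} → Prime p → ∀ l .{{_ : ℤ.NonZero l}} → ∣ l ∣ < p → ∃[ u ] + p ∣ l · u - 1ℤ
prime⇒invertible pp +[1+ n ] l<p = bézout⇒invertible (coprime-Bézout (prime⇒coprime pp l<p))
prime⇒invertible {p} pp -[1+ n ] l<p with u , p∣nu-1 ← prime⇒invertible pp +[1+ n ] l<p =
  - u , subst (+ p ∣_) (sign-cancel +[1+ n ] u) p∣nu-1
  where
  sign-cancel : ∀ a u → a · u - 1ℤ ≡ (- a) · (- u) - 1ℤ
  sign-cancel = solve-∀

prime⇒solvable : ∀ {p} → Prime p → ∀ l m → ∣ l ∣ < p → (l ≡ 0ℤ → m ≡ 0ℤ) → ∃[ c ] + p ∣ l · c - m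
prime⇒solvable pp (+ ℕ.zero) m _ l≡0⇒m≡0 with refl ← l≡0⇒m≡0 refl = 0ℤ , divides 0ℤ refl
prime⇒solvable pp l@(+[1+ _ ]) m l<p _ = inverse⇒solution l m (prime⇒invertible pp l l<p)
prime⇒solvable pp l@(-[1+ _ ]) m l<p _ = inverse⇒solution l m (prime⇒invertible pp l l<p)

expr-≡-first : ∀ {n} l0 l1 l2 m1 m2 {a b x x' y c} →
  + n ∣ a - c · (x' - x) → + n ∣ b - 0ℤ → + n ∣ l1 · c - m1 →
  + n ∣ expr l0 l1 l2 m1 m2 a b x y - (m1 · x' + m2 · y)
expr-≡-first {n} l0 l1 l2 m1 m2 {a} {b} {x} {x'} {y} {c} a≡cd b≡0 l1c≡m1 =
  subst (+ n ∣_) (sym (split l0 l1 l2 m1 m2 a b x x' y c))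
    (∣m∣n⇒∣m+n (∣m∣n⇒∣m+n (∣n⇒∣m*n (l0 · a + l2) b≡0) (∣n⇒∣m*n l1 a≡cd)) (∣m⇒∣m*n (x' - x) l1c≡m1))
  where
  split : ∀ l0 l1 l2 m1 m2 a b x x' y c →
    l0 · a · b + l1 · a + m1 · x + l2 · b + m2 · y - (m1 · x' + m2 · y)
      ≡ (l0 · a + l2) · (b - 0ℤ) + l1 · (a - c · (x' - x)) + (l1 · c - m1) · (x' - x)
  split = solve-∀

expr-≡-second : ∀ {n} l0 l1 l2 m1 m2 {a b x y y' c} →
  + n ∣ a - 0ℤ → + n ∣ b - c · (y' - y) → + n ∣ l2 · c - m2 →
  + n ∣ expr l0 l1 l2 m1 m2 a b x y - (m1 · x + m2 · y')
expr-≡-second {n} l0 l1 l2 m1 m2 {a} {b} {x} {y} {y'} {c} a≡0 b≡cd l2c≡m2 =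
  subst (+ n ∣_) (sym (split l0 l1 l2 m1 m2 a b x y y' c))
    (∣m∣n⇒∣m+n (∣m∣n⇒∣m+n (∣n⇒∣m*n (l0 · b + l1) a≡0) (∣n⇒∣m*n l2 b≡cd)) (∣m⇒∣m*n (y' - y) l2c≡m2))
  where
  split : ∀ l0 l1 l2 m1 m2 a b x y y' c →
    l0 · a · b + l1 · a + m1 · x + l2 · b + m2 · y - (m1 · x + m2 · y')
      ≡ (l0 · b + l1) · (a - 0ℤ) + l2 · (b - c · (y' - y)) + (l2 · c - m2) · (y' - y)
  split = solve-∀

toZZ : ∀ {p q} .{{_ : ℕ.NonZero p}} .{{_ : ℕ.NonZero q}} → ℤ → ℤ → ZZ p q
toZZ {p} {q} a b = reduce p a , reduce q b

α : ∀ {p q} .{{_ : ℕ.NonZero p}} .{{_ : ℕ.NonZero q}} → ℤ → ZZ p q → ZZ p q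
α c (x₁ , x₂) = toZZ (c · (lift x₂ - lift x₁)) 0ℤ

β : ∀ {p q} .{{_ : ℕ.NonZero p}} .{{_ : ℕ.NonZero q}} → ℤ → ZZ p q → ZZ p q
β c (y₁ , y₂) = toZZ 0ℤ (c · (lift y₁ - lift y₂))

residues : ℕ → ℕ → ℤ → ℕ × ℕ
residues p q s = red p s , red q s

fval-α-β : ∀ l0 l1 l2 m1 m2 {p q} .{{_ : ℕ.NonZero p}} .{{_ : ℕ.NonZero q}} {c₁ c₂} →
  + p ∣ l1 · c₁ - m1 → + q ∣ l2 · c₂ - m2 → (x y : ZZ p q) →
  fval p q l0 l1 l2 m1 m2 (α c₁) (β c₂) x y ≡ residues p q (m1 · lift (proj₂ x) + m2 · lift (proj₁ y))
fval-α-β l0 l1 l2 m1 m2 {p} {q} {c₁} {c₂} l1c₁≡m1 l2c₂≡m2 (x₁ , x₂) (y₁ , y₂) = cong₂ _,_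
  (red-cong p (expr-≡-first l0 l1 l2 m1 m2
    (lift∘reduce-≡-mod p (c₁ · (lift x₂ - lift x₁))) (lift∘reduce-≡-mod p 0ℤ) l1c₁≡m1))
  (red-cong q (expr-≡-second l0 l1 l2 m1 m2
    (lift∘reduce-≡-mod q 0ℤ) (lift∘reduce-≡-mod q (c₂ · (lift y₁ - lift y₂))) l2c₂≡m2))

range : ℕ → List ℤ
range M = applyUpTo (_⊖ M) (ℕ.suc (M ℕ.+ M))

length-range : ∀ M → length (range M) ≡ ℕ.suc (M ℕ.+ M)
length-range M = length-applyUpTo (_⊖ M) (ℕ.suc (M ℕ.+ M))

∈-range : ∀ {M} z → ∣ z ∣ ≤ M → z ∈ range M
∈-range {M} (+ n) n≤M = subst (_∈ range M) [n+M]⊖M≡n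
  (∈-applyUpTo⁺ (_⊖ M) (ℕ.s≤s (ℕP.+-monoˡ-≤ M n≤M)))
  where
  open ≡-Reasoning
  [n+M]⊖M≡n : (n ℕ.+ M) ⊖ M ≡ + n
  [n+M]⊖M≡n = begin
    (n ℕ.+ M) ⊖ M       ≡⟨ ℤP.⊖-≥ (ℕP.m≤n+m M n) ⟩
    + (n ℕ.+ M ℕ.∸ M)   ≡⟨ cong +_ (ℕP.m+n∸n≡m n M) ⟩
    + n                 ∎
∈-range {M} -[1+ n ] n<M = subst (_∈ range M) [M∸1+n]⊖M≡-1-n
  (∈-applyUpTo⁺ (_⊖ M) (ℕ.s≤s (ℕP.≤-trans (ℕP.m∸n≤m M (ℕ.suc n)) (ℕP.m≤m+n M M))))
  where
  open ≡-Reasoning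
  [M∸1+n]⊖M≡-1-n : (M ℕ.∸ ℕ.suc n) ⊖ M ≡ -[1+ n ]
  [M∸1+n]⊖M≡-1-n = begin
    (M ℕ.∸ ℕ.suc n) ⊖ M          ≡⟨ ℤP.⊖-≤ (ℕP.m∸n≤m M (ℕ.suc n)) ⟩
    - + (M ℕ.∸ (M ℕ.∸ ℕ.suc n))  ≡⟨ cong (λ k → - + k) (ℕP.m∸[m∸n]≡n n<M) ⟩
    -[1+ n ]                     ∎

∣mx+ny∣≤[∣m∣+∣n∣]*B : ∀ m n {x y B} → x ≤ B → y ≤ B → ∣ m · + x + n · + y ∣ ≤ (∣ m ∣ ℕ.+ ∣ n ∣) * B
∣mx+ny∣≤[∣m∣+∣n∣]*B m n {x} {y} {B} x≤B y≤B = begin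
  ∣ m · + x + n · + y ∣        ≤⟨ ℤP.∣i+j∣≤∣i∣+∣j∣ (m · + x) (n · + y) ⟩
  ∣ m · + x ∣ ℕ.+ ∣ n · + y ∣  ≡⟨ cong₂ ℕ._+_ (ℤP.abs-* m (+ x)) (ℤP.abs-* n (+ y)) ⟩
  ∣ m ∣ * x ℕ.+ ∣ n ∣ * y      ≤⟨ ℕP.+-mono-≤ (ℕP.*-monoʳ-≤ ∣ m ∣ x≤B) (ℕP.*-monoʳ-≤ ∣ n ∣ y≤B) ⟩
  ∣ m ∣ * B ℕ.+ ∣ n ∣ * B      ≡⟨ ℕP.*-distribʳ-+ B ∣ m ∣ ∣ n ∣ ⟨
  (∣ m ∣ ℕ.+ ∣ n ∣) * B        ∎
  where open ℕP.≤-Reasoning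

1+2kq≤[1+2k]q : ∀ k q .{{_ : ℕ.NonZero q}} → ℕ.suc (k * q ℕ.+ k * q) ≤ ℕ.suc (k ℕ.+ k) * q
1+2kq≤[1+2k]q k q = begin
  ℕ.suc (k * q ℕ.+ k * q)  ≤⟨ ℕP.+-monoˡ-≤ (k * q ℕ.+ k * q) (ℕ.>-nonZero⁻¹ q) ⟩
  q ℕ.+ (k * q ℕ.+ k * q)  ≡⟨ cong (q ℕ.+_) (ℕP.*-distribʳ-+ q k k) ⟨
  ℕ.suc (k ℕ.+ k) * q      ∎
  where open ℕP.≤-Reasoning

few-values : ∀ l0 l1 l2 m1 m2 {p q} → Prime p → Prime q → p ≤ q → ∀ {c₁ c₂} →
  + p ∣ l1 · c₁ - m1 → + q ∣ l2 · c₂ - m2 →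
  let K = ∣ m1 ∣ ℕ.+ ∣ m2 ∣ in
  Σ (ZZ p q → ZZ p q) λ α → Σ (ZZ p q → ZZ p q) λ β → Σ (List (ℕ × ℕ)) λ L →
    length L ≤ ℕ.suc (K ℕ.+ K) * q × ((x y : ZZ p q) → fval p q l0 l1 l2 m1 m2 α β x y ∈ L)
few-values l0 l1 l2 m1 m2 {p} {q} pp pq p≤q {c₁} {c₂} l1c₁≡m1 l2c₂≡m2 =
  α c₁ , β c₂ , L , length-L , fval∈L
  where
  instance
    p≢0 : ℕ.NonZero p
    p≢0 = prime⇒nonZero pp
    q≢0 : ℕ.NonZero q
    q≢0 = prime⇒nonZero pq
  K = ∣ m1 ∣ ℕ.+ ∣ m2 ∣
  L = map (residues p q) (range (K * q))
  length-L : length L ≤ ℕ.suc (K ℕ.+ K) * q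
  length-L = subst (_≤ ℕ.suc (K ℕ.+ K) * q)
    (sym (trans (length-map (residues p q) (range (K * q))) (length-range (K * q))))
    (1+2kq≤[1+2k]q K q)
  fval∈L : (x y : ZZ p q) → fval p q l0 l1 l2 m1 m2 (α c₁) (β c₂) x y ∈ L
  fval∈L x y = subst (_∈ L) (sym (fval-α-β l0 l1 l2 m1 m2 l1c₁≡m1 l2c₂≡m2 x y))
    (∈-map⁺ (residues p q) (∈-range _ (∣mx+ny∣≤[∣m∣+∣n∣]*B m1 m2
      (ℕP.<⇒≤ (toℕ<n (proj₂ x))) (ℕP.≤-trans (ℕP.<⇒≤ (toℕ<n (proj₁ y))) p≤q))))

proposition2 : (l0 l1 l2 m1 m2 : ℤ) → (l1 ≡ 0ℤ → m1 ≡ 0ℤ) → (l2 ≡ 0ℤ → m2 ≡ 0ℤ) →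
    Σ ℕ (λ C → (p q : ℕ) → Prime p → Prime q → p ≤ q →
      ∣ l1 ∣ < p → ∣ l2 ∣ < p → ∣ l1 ∣ < q → ∣ l2 ∣ < q →
      Σ (ZZ p q → ZZ p q) (λ α → Σ (ZZ p q → ZZ p q) (λ β →
        Σ (List (ℕ × ℕ)) (λ L → length L ≤ C * q ×
          ((x y : ZZ p q) → fval p q l0 l1 l2 m1 m2 α β x y ∈ L)))))
proposition2 l0 l1 l2 m1 m2 l1≡0⇒m1≡0 l2≡0⇒m2≡0 =
  ℕ.suc (K ℕ.+ K) , λ p q pp pq p≤q l1<p _ _ l2<q →
    few-values l0 l1 l2 m1 m2 pp pq p≤q
      (proj₂ (prime⇒solvable pp l1 m1 l1<p l1≡0⇒m1≡0))
      (proj₂ (prime⇒solvable pq l2 m2 l2<q l2≡0⇒m2≡0))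
  where
  K = ∣ m1 ∣ ℕ.+ ∣ m2 ∣
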